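{- Let $P$ be a graded poset, $k$ a positive real number and $\ell$ a positive integer. Then $P$ is $k$-Eulerian if and only if $D^\ell P$ is $k\ell$-Eulerian.
   Context: A graded poset is a finite poset with unique minimum $\hat 0$, unique maximum $\hat 1$, and a rank function $\rho$ with $\rho(\hat0)=0$ and $\rho(y)-\rho(x)=1$ when $y$ covers $x$; $\rho(x,y)=\rho(y)-\rho(x)$. $D^\ell P$ is obtained from $P$ by replacing each $x\in P\setminus\{\hat0,\hat1\}$ by $\ell$ elements $x_1,\dots,x_\ell$, keeping $\hat0,\hat1$, with $x_i<y_j$ iff $x<y$ in $P$. The $k$-Möbius function: $\mu_k([x,x])=1$ and, for $x<y$, $\mu_k([x,y])=-1-\frac1k\sum_{x<z<y}\mu_k([x,z])$. A graded poset is $k$-Eulerian if $\mu_k([x,y])=(-1)^{\rho(x,y)}$ for every interval $[x,y]$. -}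

module Defs where

open import Level using (Level; _⊔_)
open import Data.Nat using (ℕ; zero; suc; _∸_)
open import Data.Fin using (Fin)
open import Data.List using (List; []; _∷_; _++_; map; filter; foldr; length; allFin)
open import Data.List.Membership.Propositional using (_∈_)
open import Data.List.Relation.Unary.Unique.Propositional using (Unique)
open import Data.Product using (_×_; _,_)
open import Data.Sum using (_⊎_; inj₁; inj₂)
open import Data.Empty using (⊥)
open import Relation.Nullary using (¬_; Dec; yes; no; ¬?)
open import Relation.Nullary.Decidable using (_×-dec_)
open import Relation.Binary using (Rel; Decidable; DecidableEquality; IsPartialOrder)
open import Relation.Binary.PropositionalEquality using (_≡_; _≢_; refl)
open import Algebra.Bundles using (CommutativeRing)

-- The data part (carrier, order, enumeration, 0̂, 1̂, ρ) is separated from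
-- the axioms (IsGradedPoset) so that D^ℓ P can be built as pure data.

record FinRankedPoset : Set₁ where
  field
    Carrier : Set
    _≤_     : Carrier → Carrier → Set
    _≟_     : DecidableEquality Carrier
    _≤?_    : Decidable _≤_
    elems   : List Carrier
    0̂ 1̂    : Carrier
    ρ       : Carrier → ℕ

  _<_ : Carrier → Carrier → Set
  x < y = x ≤ y × x ≢ y

  _<?_ : Decidable _<_
  x <? y = (x ≤? y) ×-dec ¬? (x ≟ y)

  _⋖_ : Carrier → Carrier → Set
  x ⋖ y = x < y × (∀ z → ¬ (x < z × z < y))

  ρ[_,_] : Carrier → Carrier → ℕ
  ρ[ x , y ] = ρ y ∸ ρ x

record IsGradedPoset (P : FinRankedPoset) : Set where
  open FinRankedPoset P
  field
    isPartialOrder : IsPartialOrder _≡_ _≤_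
    elems-complete : ∀ x → x ∈ elems
    elems-unique   : Unique elems
    0̂-min          : ∀ x → 0̂ ≤ x
    1̂-max          : ∀ x → x ≤ 1̂
    ρ-0̂            : ρ 0̂ ≡ 0
    ρ-cover        : ∀ {x y} → x ⋖ y → ρ y ≡ suc (ρ x)

-- D^ℓ P : every x ∉ {0̂,1̂} is replaced by ℓ copies x_i (i : Fin ℓ);
-- 0̂ and 1̂ are kept ("base" elements); x_i < y_j iff x < y in P.

module Doubling (P : FinRankedPoset) (ℓ : ℕ) where
  open FinRankedPoset P

  data DElem : Set where
    base : (x : Carrier) → .(x ≡ 0̂ ⊎ x ≡ 1̂) → DElem
    mid  : (x : Carrier) → .(x ≢ 0̂) → .(x ≢ 1̂) → Fin ℓ → DElem

  under : DElem → Carrier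
  under (base x _)    = x
  under (mid x _ _ _) = x

  _≤D_ : DElem → DElem → Set
  mid x _ _ i ≤D mid y _ _ j = (x ≡ y × i ≡ j) ⊎ (x < y)
  a           ≤D b           = under a ≤ under b

  _≟D_ : DecidableEquality DElem
  base x _ ≟D base y _ with x ≟ y
  ... | yes refl = yes refl
  ... | no ne    = no λ { refl → ne refl }
  base _ _ ≟D mid _ _ _ _ = no λ ()
  mid _ _ _ _ ≟D base _ _ = no λ ()
  mid x _ _ i ≟D mid y _ _ j with x ≟ y | i Data.Fin.≟ j
  ... | yes refl | yes refl = yes refl
  ... | no ne    | _        = no λ { refl → ne refl }
  ... | yes _    | no ne    = no λ { refl → ne refl }

  _≤D?_ : Decidable _≤D_
  mid x _ _ i ≤D? mid y _ _ j = ((x ≟ y) ×-dec (i Data.Fin.≟ j)) Relation.Nullary.Decidable.⊎-dec (x <? y)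
  base x _    ≤D? base y _    = x ≤? y
  base x _    ≤D? mid y _ _ _ = x ≤? y
  mid x _ _ _ ≤D? base y _    = x ≤? y

  copies : Carrier → List DElem
  copies x with x ≟ 0̂
  ... | yes p = base x (inj₁ p) ∷ []
  ... | no p with x ≟ 1̂
  ...   | yes q = base x (inj₂ q) ∷ []
  ...   | no q  = map (mid x p q) (allFin ℓ)

  D : FinRankedPoset
  D = record
    { Carrier = DElem
    ; _≤_     = _≤D_
    ; _≟_     = _≟D_
    ; _≤?_    = _≤D?_
    ; elems   = foldr (λ x xs → copies x ++ xs) [] elems
    ; 0̂       = base 0̂ (inj₁ refl)
    ; 1̂       = base 1̂ (inj₂ refl)
    ; ρ       = λ a → ρ (under a)
    }

Dpow : ℕ → FinRankedPoset → FinRankedPoset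
Dpow ℓ P = Doubling.D P ℓ

-- The paper takes k a positive real; the only property of k used
-- by the definitions is that k (and kℓ) is invertible.  We work in an
-- arbitrary commutative ring and carry k together with a chosen inverse.

module _ {c r : Level} (R : CommutativeRing c r) where
  open CommutativeRing R

  record Invertible : Set (c ⊔ r) where
    field
      val : Carrier
      inv : Carrier
      val*inv≈1 : val * inv ≈ 1#

  _·_ : ℕ → Carrier → Carrier
  zero  · x = 0#
  suc n · x = x + n · x

  sign : ℕ → Carrier
  sign zero    = 1#
  sign (suc n) = - sign n

  sumR : List Carrier → Carrier
  sumR = foldr _+_ 0#

  module _ (k : Invertible) (P : FinRankedPoset) where
    open Invertible k
    open FinRankedPoset P renaming (Carrier to El)

    -- μ_k with explicit fuel; with fuel ≥ |P| (the length of every chain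
    -- plus one) the recursion below is the defining recursion of μ_k:
    --   μ_k([x,x]) = 1,  μ_k([x,y]) = -1 - (1/k) Σ_{x<z<y} μ_k([x,z]).
    μ-fuel : ℕ → El → El → Carrier
    μ-fuel zero    x y = 0#
    μ-fuel (suc f) x y with x ≟ y
    ... | yes _ = 1#
    ... | no _  = - 1# - inv * sumR (map (μ-fuel f x)
                                      (filter (λ z → (x <? z) ×-dec (z <? y)) elems))

    μ[_,_] : El → El → Carrier
    μ[ x , y ] = μ-fuel (length elems) x y

    IsEulerian : Set (r)
    IsEulerian = ∀ x y → x ≤ y → μ[ x , y ] ≈ sign ρ[ x , y ]

{-# OPTIONS --safe #-}
module Submission where

-- Strictly between a < b in D^ℓ P lie exactly the ℓ copies of each element strictly between
-- their images x < y in P: the endpoints 0̂ and 1̂, the only elements with a single copy, are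
-- never strictly inside an interval. By induction every copy of z carries the value μ_k([x,z]),
-- so the sum defining μ_kℓ([a,b]) is ℓ times the one defining μ_k([x,y]), and (1/kℓ)·ℓ = 1/k.
-- Hence μ_kℓ([a,b]) = μ_k([x,y]); ranks are inherited and every interval of P lifts to
-- D^ℓ P, so the two Eulerian conditions coincide. Because μ is computed with fuel, one also
-- needs that it stabilises once the fuel exceeds the length of every chain, which in D^ℓ P is
-- less than |P| by pigeonhole.

open import Defs
open import Level using (Level; 0ℓ)
open import Algebra.Bundles using (CommutativeRing)
open import Function using (_∘_)
open import Function.Bundles using (_⇔_; mk⇔)
open import Data.Nat as ℕ using (ℕ; zero; suc; _≤_; _<_; z≤n; s≤s; z<s)
open import Data.Nat.Properties using (≤-pred; <⇒≤; ≮⇒≥; +-mono-≤)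
open import Data.Fin as Fin using (Fin)
open import Data.Fin.Properties using (pigeonhole)
open import Data.List using (List; []; _∷_; _++_; map; filter; foldr; length; allFin)
open import Data.List.Properties using (map-++; filter-++; filter-all; filter-none; filter-≐; length-map; length-tabulate; length-++)
open import Data.List.Relation.Unary.All as All using (All; []; _∷_)
open import Data.List.Relation.Unary.All.Properties using (all-filter; map⁺)
open import Data.List.Relation.Unary.Any as Any using ()
open import Data.List.Membership.Propositional using (_∈_)
open import Data.List.Membership.Propositional.Properties using (∈-length)
open import Data.List.Membership.Setoid.Properties using (index-injective)
open import Data.Product using (_×_; _,_; proj₁; proj₂)
open import Data.Sum using (_⊎_; inj₁; inj₂; [_,_])
open import Data.Empty using (⊥-elim-irr)
open import Relation.Nullary using (¬_; yes; no; contradiction; _×-dec_)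
open import Relation.Unary using (Pred)
import Relation.Unary as Unary
open import Relation.Binary using (Rel; Transitive; Irreflexive; IsPartialOrder)
open import Relation.Binary.PropositionalEquality as ≡ using (_≡_; _≢_; cong)
import Relation.Binary.Construct.NonStrictToStrict as Strict

data Chain {A : Set} (_≺_ : Rel A 0ℓ) : A → A → ℕ → Set where
  []  : ∀ {x} → Chain _≺_ x x 0
  _∷_ : ∀ {x y z m} → x ≺ y → Chain _≺_ y z m → Chain _≺_ x z (suc m)

module _ {A : Set} {_≺_ : Rel A 0ℓ} where

  infixl 5 _∷ʳ_

  _∷ʳ_ : ∀ {x y z m} → Chain _≺_ x y m → y ≺ z → Chain _≺_ x z (suc m)
  []       ∷ʳ y≺z = y≺z ∷ []
  (p ∷ ps) ∷ʳ y≺z = p ∷ (ps ∷ʳ y≺z)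

  vertex : ∀ {x y m} → Chain _≺_ x y m → Fin (suc m) → A
  vertex {x} _        Fin.zero    = x
  vertex     (_ ∷ ps) (Fin.suc i) = vertex ps i

  vertex-increasing : Transitive _≺_ → ∀ {x y m} (c : Chain _≺_ x y m) {i j} →
                      i Fin.< j → vertex c i ≺ vertex c j
  vertex-increasing ≺-trans (p ∷ ps) {Fin.zero} {Fin.suc Fin.zero}    _ = p
  vertex-increasing ≺-trans (p ∷ ps) {Fin.zero} {Fin.suc (Fin.suc j)} _ =
    ≺-trans p (vertex-increasing ≺-trans ps {Fin.zero} {Fin.suc j} z<s)
  vertex-increasing ≺-trans (p ∷ ps) {Fin.suc i} {Fin.suc j} (s≤s i<j) =
    vertex-increasing ≺-trans ps i<j

  -- Pigeonhole: the m + 1 vertices of a chain are pairwise distinct.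
  chain-length< : Transitive _≺_ → Irreflexive _≡_ _≺_ →
                  ∀ {xs} → (∀ x → x ∈ xs) → ∀ {x y m} → Chain _≺_ x y m → m < length xs
  chain-length< ≺-trans ≺-irrefl {xs} complete {m = m} c with m ℕ.<? length xs
  ... | yes m<n = m<n
  ... | no m≮n with pigeonhole (s≤s (≮⇒≥ m≮n)) (Any.index ∘ complete ∘ vertex c)
  ...   | i , j , i<j , same-index =
    contradiction (vertex-increasing ≺-trans c i<j)
      (≺-irrefl (index-injective (≡.setoid A) (complete _) (complete _) same-index))

chain-map : ∀ {A B : Set} {_≺₁_ : Rel A 0ℓ} {_≺₂_ : Rel B 0ℓ} {f : A → B} →
            (∀ {x y} → x ≺₁ y → f x ≺₂ f y) →
            ∀ {x y m} → Chain _≺₁_ x y m → Chain _≺₂_ (f x) (f y) m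
chain-map f-mono []       = []
chain-map f-mono (p ∷ ps) = f-mono p ∷ chain-map f-mono ps

module RingSums {c r} (R : CommutativeRing c r) where
  open CommutativeRing R
  open import Algebra.Properties.Monoid.Mult +-monoid public using () renaming (_×_ to _×ₙ_)
  open import Algebra.Properties.Monoid.Mult +-monoid using (×-congʳ)
  open import Algebra.Properties.Semiring.Mult semiring using (×-assoc-*)
  open import Relation.Binary.Reasoning.Setoid setoid

  ·≡× : ∀ n x → _·_ R n x ≡ n ×ₙ x
  ·≡× zero    x = ≡.refl
  ·≡× (suc n) x = cong (x +_) (·≡× n x)

  ×-zeroʳ : ∀ n → n ×ₙ 0# ≈ 0#
  ×-zeroʳ zero    = refl
  ×-zeroʳ (suc n) = trans (+-identityˡ _) (×-zeroʳ n)

  sumR-++ : ∀ xs ys → sumR R (xs ++ ys) ≈ sumR R xs + sumR R ys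
  sumR-++ []       ys = sym (+-identityˡ _)
  sumR-++ (x ∷ xs) ys = trans (+-congˡ (sumR-++ xs ys)) (sym (+-assoc _ _ _))

  sumR-cong : ∀ {A : Set} {f g : A → Carrier} {xs} →
              All (λ x → f x ≈ g x) xs → sumR R (map f xs) ≈ sumR R (map g xs)
  sumR-cong []          = refl
  sumR-cong (fx≈gx ∷ p) = +-cong fx≈gx (sumR-cong p)

  sumR-constant : ∀ {A : Set} {f : A → Carrier} {v xs} →
                  All (λ x → f x ≈ v) xs → sumR R (map f xs) ≈ length xs ×ₙ v
  sumR-constant []          = refl
  sumR-constant (fx≈v ∷ p) = +-cong fx≈v (sumR-constant p)

  sumR-filter-++ : ∀ {A : Set} {Q : Pred A 0ℓ} (Q? : Unary.Decidable Q) (h : A → Carrier) xs ys →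
                   sumR R (map h (filter Q? (xs ++ ys))) ≈
                   sumR R (map h (filter Q? xs)) + sumR R (map h (filter Q? ys))
  sumR-filter-++ Q? h xs ys = begin
    sumR R (map h (filter Q? (xs ++ ys)))                    ≡⟨ cong (sumR R ∘ map h) (filter-++ Q? xs ys) ⟩
    sumR R (map h (filter Q? xs ++ filter Q? ys))            ≡⟨ cong (sumR R) (map-++ h (filter Q? xs) _) ⟩
    sumR R (map h (filter Q? xs) ++ map h (filter Q? ys))    ≈⟨ sumR-++ (map h (filter Q? xs)) _ ⟩
    sumR R (map h (filter Q? xs)) + sumR R (map h (filter Q? ys)) ∎

  inv-×-cancel : (k kℓ : Invertible R) (ℓ : ℕ) →
                 Invertible.val kℓ ≈ ℓ ×ₙ Invertible.val k →
                 ∀ s → Invertible.inv kℓ * (ℓ ×ₙ s) ≈ Invertible.inv k * s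
  inv-×-cancel k kℓ ℓ kℓ≈ℓk s = begin
    kℓ.inv * (ℓ ×ₙ s)                     ≈⟨ *-congˡ (×-congʳ ℓ (sym s≈k[k⁻¹s])) ⟩
    kℓ.inv * (ℓ ×ₙ (k.val * (k.inv * s))) ≈⟨ *-congˡ (sym (×-assoc-* ℓ k.val _)) ⟩
    kℓ.inv * ((ℓ ×ₙ k.val) * (k.inv * s)) ≈⟨ *-congˡ (*-congʳ (sym kℓ≈ℓk)) ⟩
    kℓ.inv * (kℓ.val * (k.inv * s))      ≈⟨ sym (*-assoc _ _ _) ⟩
    (kℓ.inv * kℓ.val) * (k.inv * s)      ≈⟨ *-congʳ (trans (*-comm _ _) kℓ.val*inv≈1) ⟩
    1# * (k.inv * s)                     ≈⟨ *-identityˡ _ ⟩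
    k.inv * s                            ∎
    where
    module k = Invertible k
    module kℓ = Invertible kℓ
    s≈k[k⁻¹s] : k.val * (k.inv * s) ≈ s
    s≈k[k⁻¹s] = trans (sym (*-assoc _ _ _)) (trans (*-congʳ k.val*inv≈1) (*-identityˡ s))

module _ (Q : FinRankedPoset) where
  open FinRankedPoset Q renaming (_<_ to _⊏_)

  Between : Carrier → Carrier → Pred Carrier 0ℓ
  Between x y z = x ⊏ z × z ⊏ y

  between? : ∀ x y → Unary.Decidable (Between x y)
  between? x y z = (x <? z) ×-dec (z <? y)

module MöbiusFuel {c r} (R : CommutativeRing c r) (k : Invertible R) (Q : FinRankedPoset) where
  open CommutativeRing R
  open FinRankedPoset Q using (_≟_; elems) renaming (_<_ to _⊏_)
  open RingSums R using (sumR-cong)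

  -- The recursion only ever descends along chains.
  μ-fuel-stable : ∀ {f g x y} → (∀ {m} → Chain _⊏_ x y m → m < f) → 1 ≤ f → f ≤ g →
                  μ-fuel R k Q f x y ≈ μ-fuel R k Q g x y
  μ-fuel-stable {suc f} {suc g} {x} {y} bounded _ (s≤s f≤g) with x ≟ y
  ... | yes _ = refl
  ... | no  _ = +-congˡ (-‿cong (*-congˡ (sumR-cong (All.map agree (all-filter _ elems)))))
    where
    agree : ∀ {z} → Between Q x y z → μ-fuel R k Q f x z ≈ μ-fuel R k Q g x z
    agree (x⊏z , z⊏y) = μ-fuel-stable bounded′ (<⇒≤ (bounded′ (x⊏z ∷ []))) f≤g
      where
      bounded′ : ∀ {m} → Chain _⊏_ x _ m → m < f
      bounded′ c = ≤-pred (bounded (c ∷ʳ z⊏y))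

module Doubled (P : FinRankedPoset) (G : IsGradedPoset P) (ℓ : ℕ) (ℓ≥1 : 1 ≤ ℓ) where
  open FinRankedPoset P renaming (Carrier to El; _≤_ to _⊑_; _<_ to _⊏_)
  open IsGradedPoset G
  open IsPartialOrder isPartialOrder using (antisym) renaming (refl to ⊑-refl)
  open Doubling P ℓ
  open FinRankedPoset D using () renaming (_<_ to _⊏D_)

  ⊏-trans : Transitive _⊏_
  ⊏-trans = Strict.<-trans _≡_ _⊑_ isPartialOrder

  ¬⊏0̂ : ∀ {x} → ¬ (x ⊏ 0̂)
  ¬⊏0̂ x⊏0̂ = Strict.<⇒≱ _≡_ _⊑_ antisym x⊏0̂ (0̂-min _)

  ¬1̂⊏ : ∀ {x} → ¬ (1̂ ⊏ x)
  ¬1̂⊏ 1̂⊏x = Strict.<⇒≱ _≡_ _⊑_ antisym 1̂⊏x (1̂-max _)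

  base-unique : ∀ {x} .(e : x ≡ 0̂ ⊎ x ≡ 1̂) b → x ≡ under b → base x e ≡ b
  base-unique e (base _ _)             ≡.refl = ≡.refl
  base-unique e (mid _ x≢0̂ x≢1̂ _) ≡.refl = ⊥-elim-irr ([ x≢0̂ , x≢1̂ ] e)

  under-⊏ : ∀ {a b} → a ⊏D b → under a ⊏ under b
  under-⊏ {mid _ _ _ _} {mid _ _ _ _} (inj₁ (≡.refl , ≡.refl) , a≢b) = contradiction ≡.refl a≢b
  under-⊏ {mid _ _ _ _} {mid _ _ _ _} (inj₂ x⊏y , _)                 = x⊏y
  under-⊏ {base _ e}    {b}           (x⊑y , a≢b) = x⊑y , a≢b ∘ base-unique e b
  under-⊏ {mid _ _ _ _} {base _ e}    (x⊑y , a≢b) = x⊑y , a≢b ∘ ≡.sym ∘ base-unique e _ ∘ ≡.sym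

  ⊏-under : ∀ {a b} → under a ⊏ under b → a ⊏D b
  ⊏-under {mid _ _ _ _} {mid _ _ _ _} x⊏y = inj₂ x⊏y , proj₂ x⊏y ∘ cong under
  ⊏-under {base _ _}    {_}           x⊏y = proj₁ x⊏y , proj₂ x⊏y ∘ cong under
  ⊏-under {mid _ _ _ _} {base _ _}    x⊏y = proj₁ x⊏y , proj₂ x⊏y ∘ cong under

  under-mono : ∀ {a b} → a ≤D b → under a ⊑ under b
  under-mono {mid _ _ _ _} {mid _ _ _ _} (inj₁ (≡.refl , _)) = ⊑-refl
  under-mono {mid _ _ _ _} {mid _ _ _ _} (inj₂ x⊏y)          = proj₁ x⊏y
  under-mono {base _ _}    {_}           x⊑y                 = x⊑y
  under-mono {mid _ _ _ _} {base _ _}    x⊑y                 = x⊑y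

  lift : El → DElem
  lift x with x ≟ 0̂ | x ≟ 1̂
  ... | yes x≡0̂ | _        = base x (inj₁ x≡0̂)
  ... | no _     | yes x≡1̂ = base x (inj₂ x≡1̂)
  ... | no x≢0̂  | no x≢1̂  = mid x x≢0̂ x≢1̂ (Fin.fromℕ< ℓ≥1)

  under-lift : ∀ x → under (lift x) ≡ x
  under-lift x with x ≟ 0̂ | x ≟ 1̂
  ... | yes _ | _     = ≡.refl
  ... | no _  | yes _ = ≡.refl
  ... | no _  | no _  = ≡.refl

  lift-mono : ∀ {x y} → x ⊑ y → lift x ≤D lift y
  lift-mono {x} {y} x⊑y with x ≟ 0̂ | x ≟ 1̂
  ... | yes _ | _     = ≡.subst (x ⊑_) (≡.sym (under-lift y)) x⊑y
  ... | no _  | yes _ = ≡.subst (x ⊑_) (≡.sym (under-lift y)) x⊑y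
  ... | no _  | no _  with y ≟ 0̂ | y ≟ 1̂
  ...   | yes _ | _     = x⊑y
  ...   | no _  | yes _ = x⊑y
  ...   | no _  | no _  with x ≟ y
  ...     | yes ≡.refl = inj₁ (≡.refl , ≡.refl)
  ...     | no x≢y     = inj₂ (x⊑y , x≢y)

  under-copies : ∀ x → All (λ a → under a ≡ x) (copies x)
  under-copies x with x ≟ 0̂
  ... | yes _ = ≡.refl ∷ []
  ... | no _ with x ≟ 1̂
  ...   | yes _ = ≡.refl ∷ []
  ...   | no _  = map⁺ (All.universal (λ _ → ≡.refl) (allFin ℓ))

  length-copies-middle : ∀ {x} → x ≢ 0̂ → x ≢ 1̂ → length (copies x) ≡ ℓ
  length-copies-middle {x} x≢0̂ x≢1̂ with x ≟ 0̂
  ... | yes x≡0̂ = contradiction x≡0̂ x≢0̂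
  ... | no _ with x ≟ 1̂
  ...   | yes x≡1̂ = contradiction x≡1̂ x≢1̂
  ...   | no _     = ≡.trans (length-map _ (allFin ℓ)) (length-tabulate _)

  length-copies : ∀ x → 1 ≤ length (copies x)
  length-copies x with x ≟ 0̂
  ... | yes _ = s≤s z≤n
  ... | no _ with x ≟ 1̂
  ...   | yes _ = s≤s z≤n
  ...   | no _  = ≡.subst (1 ≤_) (≡.sym (≡.trans (length-map _ (allFin ℓ)) (length-tabulate _))) ℓ≥1

  copiesOf : List El → List DElem
  copiesOf = foldr (λ x ys → copies x ++ ys) []

  length-copiesOf : ∀ xs → length xs ≤ length (copiesOf xs)
  length-copiesOf []       = z≤n
  length-copiesOf (x ∷ xs) = ≡.subst (suc (length xs) ≤_) (≡.sym (length-++ (copies x)))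
                               (+-mono-≤ (length-copies x) (length-copiesOf xs))

  chain-length<|P| : ∀ {a b m} → Chain _⊏D_ a b m → m < length elems
  chain-length<|P| = chain-length< ⊏-trans (Strict.<-irrefl _≡_ _⊑_) elems-complete ∘ chain-map under-⊏

  module CopySums {c r} (R : CommutativeRing c r) where
    open CommutativeRing R renaming (Carrier to K)
    open RingSums R
    open import Algebra.Properties.CommutativeMonoid.Mult +-commutativeMonoid using (×-distrib-+)
    open import Relation.Binary.Reasoning.Setoid setoid

    module _ {Q : Pred El 0ℓ} (Q? : Unary.Decidable Q) (¬Q0̂ : ¬ Q 0̂) (¬Q1̂ : ¬ Q 1̂) (g : El → K) where

      sumR-copies-accept : ∀ {x} → Q x →
                           sumR R (map (g ∘ under) (filter (Q? ∘ under) (copies x))) ≈ ℓ ×ₙ g x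
      sumR-copies-accept {x} Qx = begin
        sumR R (map (g ∘ under) (filter (Q? ∘ under) (copies x)))
          ≡⟨ cong (sumR R ∘ map (g ∘ under))
               (filter-all (Q? ∘ under) (All.map (λ e → ≡.subst Q (≡.sym e) Qx) (under-copies x))) ⟩
        sumR R (map (g ∘ under) (copies x))
          ≈⟨ sumR-constant (All.map (reflexive ∘ cong g) (under-copies x)) ⟩
        length (copies x) ×ₙ g x
          ≡⟨ cong (_×ₙ g x) (length-copies-middle (λ { ≡.refl → ¬Q0̂ Qx }) (λ { ≡.refl → ¬Q1̂ Qx })) ⟩
        ℓ ×ₙ g x ∎

      sumR-copies-reject : ∀ {x} → ¬ Q x →
                           sumR R (map (g ∘ under) (filter (Q? ∘ under) (copies x))) ≈ 0#
      sumR-copies-reject {x} ¬Qx = reflexive (cong (sumR R ∘ map (g ∘ under))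
        (filter-none (Q? ∘ under) (All.map (λ e Qa → ¬Qx (≡.subst Q e Qa)) (under-copies x))))

      sumR-copiesOf : ∀ xs → sumR R (map (g ∘ under) (filter (Q? ∘ under) (copiesOf xs))) ≈
                             ℓ ×ₙ sumR R (map g (filter Q? xs))
      sumR-copiesOf []       = sym (×-zeroʳ ℓ)
      sumR-copiesOf (x ∷ xs) with Q? x
      ... | yes Qx = begin
        _ ≈⟨ sumR-filter-++ (Q? ∘ under) (g ∘ under) (copies x) (copiesOf xs) ⟩
        _ ≈⟨ +-cong (sumR-copies-accept Qx) (sumR-copiesOf xs) ⟩
        ℓ ×ₙ g x + ℓ ×ₙ sumR R (map g (filter Q? xs)) ≈⟨ sym (×-distrib-+ _ _ ℓ) ⟩
        ℓ ×ₙ (g x + sumR R (map g (filter Q? xs)))    ∎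
      ... | no ¬Qx = begin
        _ ≈⟨ sumR-filter-++ (Q? ∘ under) (g ∘ under) (copies x) (copiesOf xs) ⟩
        _ ≈⟨ +-cong (sumR-copies-reject ¬Qx) (sumR-copiesOf xs) ⟩
        0# + ℓ ×ₙ sumR R (map g (filter Q? xs)) ≈⟨ +-identityˡ _ ⟩
        ℓ ×ₙ sumR R (map g (filter Q? xs))      ∎

  module MöbiusTransfer {c r} (R : CommutativeRing c r) (k kℓ : Invertible R)
                  (kℓ≈ℓk : CommutativeRing._≈_ R (Invertible.val kℓ) (_·_ R ℓ (Invertible.val k))) where
    open CommutativeRing R
    open RingSums R
    open CopySums R
    open MöbiusFuel R kℓ D using (μ-fuel-stable)
    open import Relation.Binary.Reasoning.Setoid setoid
    module k = Invertible k
    module kℓ = Invertible kℓ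

    between-under : ∀ a b → Between D a b Unary.≐ (Between P (under a) (under b) ∘ under)
    between-under a b = (λ (a⊏z , z⊏b) → under-⊏ a⊏z , under-⊏ z⊏b)
                      , (λ (a⊏z , z⊏b) → ⊏-under a⊏z , ⊏-under z⊏b)

    μ-fuel-under : ∀ f {a b} → a ≤D b → μ-fuel R kℓ D f a b ≈ μ-fuel R k P f (under a) (under b)
    μ-fuel-under zero _ = refl
    μ-fuel-under (suc f) {a} {b} a≤b with a ≟D b | under a ≟ under b
    ... | yes _     | yes _     = refl
    ... | yes ≡.refl | no x≢x   = contradiction ≡.refl x≢x
    ... | no a≢b    | yes x≡y   = contradiction x≡y (proj₂ (under-⊏ (a≤b , a≢b)))
    ... | no _      | no _      = +-congˡ (-‿cong (begin
      kℓ.inv * sumR R (map (μD a) (filter (between? D a b) elemsD))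
        ≈⟨ *-congˡ (sumR-cong (All.map (λ (a⊏z , _) → μ-fuel-under f (proj₁ a⊏z)) (all-filter _ elemsD))) ⟩
      kℓ.inv * sumR R (map (μP x ∘ under) (filter (between? D a b) elemsD))
        ≡⟨ cong (λ zs → kℓ.inv * sumR R (map (μP x ∘ under) zs))
             (filter-≐ (between? D a b) (between? P x y ∘ under) (between-under a b) elemsD) ⟩
      kℓ.inv * sumR R (map (μP x ∘ under) (filter (between? P x y ∘ under) elemsD))
        ≈⟨ *-congˡ (sumR-copiesOf (between? P x y) (¬⊏0̂ ∘ proj₁) (¬1̂⊏ ∘ proj₂) (μP x) elems) ⟩
      kℓ.inv * (ℓ ×ₙ sumR R (map (μP x) (filter (between? P x y) elems)))
        ≈⟨ inv-×-cancel k kℓ ℓ (trans kℓ≈ℓk (reflexive (·≡× ℓ k.val))) _ ⟩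
      k.inv * sumR R (map (μP x) (filter (between? P x y) elems)) ∎))
      where
      x = under a
      y = under b
      μD = μ-fuel R kℓ D f
      μP = μ-fuel R k P f
      elemsD = FinRankedPoset.elems D

    μ-under : ∀ {a b} → a ≤D b → μ[_,_] R kℓ D a b ≈ μ[_,_] R k P (under a) (under b)
    μ-under a≤b =
      trans (sym (μ-fuel-stable chain-length<|P| (∈-length (elems-complete 0̂)) (length-copiesOf elems)))
            (μ-fuel-under (length elems) a≤b)

mainTheorem6 : {c r : Level} (R : CommutativeRing c r)
    (P : FinRankedPoset) → IsGradedPoset P →
    (ℓ : ℕ) → 1 ≤ ℓ →
    (k kℓ : Invertible R) →
    CommutativeRing._≈_ R (Invertible.val kℓ) (_·_ R ℓ (Invertible.val k)) →
    (IsEulerian R k P ⇔ IsEulerian R kℓ (Dpow ℓ P))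
mainTheorem6 R P G ℓ ℓ≥1 k kℓ kℓ≈ℓk = mk⇔ to from
  where
  open CommutativeRing R using (trans; sym)
  open Doubling P ℓ using (under)
  open Doubled P G ℓ ℓ≥1
  open MöbiusTransfer R k kℓ kℓ≈ℓk

  to : IsEulerian R k P → IsEulerian R kℓ (Dpow ℓ P)
  to eulerian a b a≤b = trans (μ-under a≤b) (eulerian (under a) (under b) (under-mono {a} {b} a≤b))

  from : IsEulerian R kℓ (Dpow ℓ P) → IsEulerian R k P
  from eulerian x y x≤y with lift x | under-lift x | lift y | under-lift y | lift-mono x≤y
  ... | a | ≡.refl | b | ≡.refl | a≤b = trans (sym (μ-under a≤b)) (eulerian a b a≤b)
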